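{- Let $k\ge2$ be an integer, $\eta=1/k$, and let $\mathcal{S}_k$ be the concept class over domain $[k]$ consisting of all functions $c:[k]\to\{\pm1\}$ with $c(x)=1$ for exactly one $x\in[k]$. For every algorithm that learns $\mathcal{S}_k$ with $\eta$-malicious noise and always outputs a hypothesis supported on $\mathcal{S}_k$ (i.e., a mixture of functions in $\mathcal{S}_k$), there exist a target $c^\star\in\mathcal{S}_k$, a distribution $\mathcal{D}$ over $[k]$ and an $\eta$-malicious adversary under which the expected error $\mathbb{E}[\mathrm{error}_{\mathcal{D}}(\mathbf{h},c^\star)]$ of the output hypothesis is at least $\eta$.
   Context: $\mathrm{error}_{\mathcal{D}}(\mathbf{h},c)=\Pr_{\mathbf{x}\sim\mathcal{D},\mathbf{h}}[\mathbf{h}(\mathbf{x})\ne c(\mathbf{x})]$; the expectation is over the samples, the adversary and the algorithm's randomness. $\eta$-malicious noise: each of the $n$ sample points is independently with probability $1-\eta$ a clean point $(\mathbf{x},c^\star(\mathbf{x}))$, $\mathbf{x}\sim\mathcal{D}$, and with probability $\eta$ an arbitrary point chosen by the adversary.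
   Formalization: The output hypotheses of the algorithms are mixtures of functions in $\mathcal{S}_k$ with rational weights only, and the distribution $\mathcal{D}$ takes rational values. -}

module Defs where

open import Data.Nat as ℕ using (ℕ; zero; suc)
open import Data.Fin using (Fin)
open import Data.Bool using (Bool; true; false; if_then_else_)
open import Data.List using (List; []; _∷_; [_]; map; concatMap; allFin; foldr)
open import Data.List.Relation.Unary.All using (All)
open import Data.Vec using (Vec; []; _∷_)
open import Data.Product using (Σ; _×_; _,_; proj₁)
open import Data.Rational using (ℚ; 0ℚ; 1ℚ; _+_; _*_; _-_; _≤_; _/_)
open import Data.Integer using (+_)
open import Relation.Binary.PropositionalEquality using (_≡_)

-- Labels: true = +1, false = -1.  Domain [k] = Fin k.
Point : ℕ → Set
Point k = Fin k × Bool

sumℚ : List ℚ → ℚ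
sumℚ = foldr _+_ 0ℚ

sumFin : (k : ℕ) → (Fin k → ℚ) → ℚ
sumFin k f = sumℚ (map f (allFin k))

InSk : {k : ℕ} → (Fin k → Bool) → Set
InSk {k} c = Σ (Fin k) λ i → (c i ≡ true) × (∀ x → c x ≡ true → x ≡ i)

IsDist : (k : ℕ) → (Fin k → ℚ) → Set
IsDist k D = (∀ x → 0ℚ ≤ D x) × (sumFin k D ≡ 1ℚ)

Mixture : ℕ → Set
Mixture k = List (ℚ × (Fin k → Bool))

ValidMixture : {k : ℕ} → Mixture k → Set
ValidMixture h = All (λ qc → (0ℚ ≤ proj₁ qc) × InSk (Data.Product.proj₂ qc)) h
               × (sumℚ (map proj₁ h) ≡ 1ℚ)

disagree : Bool → Bool → ℚ
disagree true  true  = 0ℚ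
disagree false false = 0ℚ
disagree true  false = 1ℚ
disagree false true  = 1ℚ

errConcept : (k : ℕ) → (Fin k → ℚ) → (Fin k → Bool) → (Fin k → Bool) → ℚ
errConcept k D c c⋆ = sumFin k (λ x → D x * disagree (c x) (c⋆ x))

errMixture : (k : ℕ) → (Fin k → ℚ) → Mixture k → (Fin k → Bool) → ℚ
errMixture k D h c⋆ = sumℚ (map (λ qc → proj₁ qc * errConcept k D (Data.Product.proj₂ qc) c⋆) h)

vecs : {A : Set} → List A → (n : ℕ) → List (Vec A n)
vecs xs zero    = [ [] ]
vecs xs (suc n) = concatMap (λ a → map (a ∷_) (vecs xs n)) xs

bools : List Bool
bools = false ∷ true ∷ []

-- An η-malicious adversary for n samples: given the corruption pattern (true = corrupted)
-- and the clean draws of all n positions, it chooses the n points used at corrupted positions.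
Adversary : ℕ → ℕ → Set
Adversary k n = Vec Bool n → Vec (Fin k) n → Vec (Point k) n

mkSample : {k n : ℕ} → (Fin k → Bool) → Vec Bool n → Vec (Fin k) n → Vec (Point k) n → Vec (Point k) n
mkSample c []      []       []       = []
mkSample c (b ∷ m) (x ∷ xs) (p ∷ ps) = (if b then p else (x , c x)) ∷ mkSample c m xs ps

weight : {k n : ℕ} → ℚ → (Fin k → ℚ) → Vec Bool n → Vec (Fin k) n → ℚ
weight η D []      []       = 1ℚ
weight η D (b ∷ m) (x ∷ xs) = ((if b then η else (1ℚ - η)) * D x) * weight η D m xs

-- A learning algorithm for n samples outputs a mixture over S_k (its internal randomness
-- is absorbed into the mixture, since the error is linear in the output distribution).
Algorithm : ℕ → ℕ → Set
Algorithm k n = Vec (Point k) n → Mixture k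

expectedError : (k n : ℕ) → ℚ → (Fin k → ℚ) → (Fin k → Bool) → Algorithm k n → Adversary k n → ℚ
expectedError k n η D c⋆ A adv =
  sumℚ (concatMap (λ m → map (λ xs → weight η D m xs * errMixture k D (A (mkSample c⋆ m xs (adv m xs))) c⋆)
                             (vecs (allFin k) n))
                  (vecs bools n))

etaOf : (k : ℕ) → .{{_ : ℕ.NonZero k}} → ℚ
etaOf k = + 1 / k

{-# OPTIONS --safe #-}
-- For i ∈ [k] let the target be the concept c_i positive exactly at i, let D_i be uniform on
-- the other k − 1 points, and let the adversary always plant (i, −1).  As (1 − η)/(k − 1) = η,
-- every sample point is then (y, −1) with y uniform on [k], so the learner's sample has the
-- same law for every i.  On the other hand a concept of S_k positive at j has error 1/(k − 1)
-- under D_i for each i ≠ j and error 0 under D_j, so its errors sum to 1 over i, and so do the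
-- expected errors of the learner.  Hence some i has expected error at least 1/k = η.
module Submission where

open import Defs
open import Data.Nat using (ℕ; _≤_; NonZero)
open import Data.Fin using (Fin)
open import Data.Bool using (Bool)
open import Data.Vec using (Vec)
open import Data.Product using (Σ; _×_)
open import Data.Rational using (ℚ)
import Data.Rational

open import Data.Bool using (true; false; if_then_else_)
open import Data.Fin using (zero; suc; punchIn)
open import Data.Fin.Properties using (_≟_; punchInᵢ≢i)
open import Data.Integer as ℤ using (ℤ)
import Data.Integer.Properties as ℤ
open import Data.Integer.Tactic.RingSolver using (solve-∀)
open import Data.List using (List; []; _∷_; map; concatMap; allFin; tabulate; _++_)
import Data.List.Properties as List
open import Data.List.Relation.Unary.All as All using (All; []; _∷_)
open import Data.List.Relation.Unary.All.Properties using (¬Any⇒All¬)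
open import Data.List.Relation.Unary.Any using (any?; satisfied)
open import Data.Nat as ℕ using (zero; suc; s≤s)
open import Data.Product using (_,_; proj₁; proj₂; ∃)
open import Data.Rational as ℚ using (0ℚ; 1ℚ; _+_; _*_; _-_; _<_; toℚᵘ)
import Data.Rational.Properties as ℚ
open import Algebra.Properties.CommutativeMonoid.Sum ℚ.+-0-commutativeMonoid
  using (sum; sum-remove; sum-replicate)
open import Algebra.Properties.Monoid.Mult ℚ.+-0-monoid using () renaming (_×_ to _·_)
open import Data.Rational.Solver using (module +-*-Solver)
open +-*-Solver using (solve; _:+_; _:-_; _:*_; _:=_; con)
open import Data.Rational.Unnormalised as ℚᵘ using (mkℚᵘ; *≡*)
import Data.Rational.Unnormalised.Properties as ℚᵘ
open import Data.Vec using ([]; _∷_; replicate)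
open import Function using (_∘_; mk⇔)
open import Relation.Binary.PropositionalEquality
open import Relation.Nullary using (yes; no; does)
open import Relation.Nullary.Decidable using (dec-true; dec-false; does-⇔)
open import Relation.Nullary.Negation using (contradiction)

private variable
  A B I Y : Set

∑ : List A → (A → ℚ) → ℚ
∑ xs f = sumℚ (map f xs)

syntax ∑ xs (λ x → e) = ∑[ x ∈ xs ] e

∑-cong : (xs : List A) {f g : A → ℚ} → (∀ x → f x ≡ g x) → ∑ xs f ≡ ∑ xs g
∑-cong xs f≗g = cong sumℚ (List.map-cong f≗g xs)

∑-cong-on : {xs : List A} {f g : A → ℚ} → All (λ x → f x ≡ g x) xs → ∑ xs f ≡ ∑ xs g
∑-cong-on f≡g = cong sumℚ (List.map-cong-local f≡g)

∑-0 : (xs : List A) → ∑[ _ ∈ xs ] 0ℚ ≡ 0ℚ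
∑-0 []       = refl
∑-0 (x ∷ xs) = trans (cong (0ℚ +_) (∑-0 xs)) (ℚ.+-identityˡ 0ℚ)

∑-distrib-+ : (xs : List A) (f g : A → ℚ) → ∑[ x ∈ xs ] (f x + g x) ≡ ∑ xs f + ∑ xs g
∑-distrib-+ []       f g = refl
∑-distrib-+ (x ∷ xs) f g = trans (cong (f x + g x +_) (∑-distrib-+ xs f g))
  (solve 4 (λ a b c d → (a :+ b) :+ (c :+ d) := (a :+ c) :+ (b :+ d)) refl
           (f x) (g x) (∑ xs f) (∑ xs g))

∑-*ˡ : (xs : List A) (c : ℚ) (f : A → ℚ) → ∑[ x ∈ xs ] (c * f x) ≡ c * ∑ xs f
∑-*ˡ []       c f = sym (ℚ.*-zeroʳ c)
∑-*ˡ (x ∷ xs) c f = trans (cong (c * f x +_) (∑-*ˡ xs c f)) (sym (ℚ.*-distribˡ-+ c (f x) (∑ xs f)))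

∑-*ʳ : (xs : List A) (c : ℚ) (f : A → ℚ) → ∑[ x ∈ xs ] (f x * c) ≡ ∑ xs f * c
∑-*ʳ []       c f = sym (ℚ.*-zeroˡ c)
∑-*ʳ (x ∷ xs) c f = trans (cong (f x * c +_) (∑-*ʳ xs c f)) (sym (ℚ.*-distribʳ-+ c (f x) (∑ xs f)))

∑-comm : (xs : List A) (ys : List B) (f : A → B → ℚ) →
         ∑[ x ∈ xs ] ∑[ y ∈ ys ] f x y ≡ ∑[ y ∈ ys ] ∑[ x ∈ xs ] f x y
∑-comm []       ys f = sym (∑-0 ys)
∑-comm (x ∷ xs) ys f = trans (cong (∑ ys (f x) +_) (∑-comm xs ys f))
  (sym (∑-distrib-+ ys (f x) (λ y → ∑[ x ∈ xs ] f x y)))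

∑-map : (h : A → B) (xs : List A) (f : B → ℚ) → ∑ (map h xs) f ≡ ∑[ x ∈ xs ] f (h x)
∑-map h xs f = cong sumℚ (sym (List.map-∘ xs))

sum-++ : (ps qs : List ℚ) → sumℚ (ps ++ qs) ≡ sumℚ ps + sumℚ qs
sum-++ []       qs = sym (ℚ.+-identityˡ (sumℚ qs))
sum-++ (p ∷ ps) qs = trans (cong (p +_) (sum-++ ps qs)) (sym (ℚ.+-assoc p (sumℚ ps) (sumℚ qs)))

sum-concatMap : (g : A → List ℚ) (xs : List A) → sumℚ (concatMap g xs) ≡ ∑[ x ∈ xs ] sumℚ (g x)
sum-concatMap g []       = refl
sum-concatMap g (x ∷ xs) = trans (sum-++ (g x) _) (cong (sumℚ (g x) +_) (sum-concatMap g xs))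

∑-concatMap : (g : A → List B) (xs : List A) (f : B → ℚ) →
              ∑ (concatMap g xs) f ≡ ∑[ x ∈ xs ] ∑ (g x) f
∑-concatMap g xs f = trans (cong sumℚ (List.map-concatMap f g xs)) (sum-concatMap (map f ∘ g) xs)

∑-mono-< : {x : A} {xs : List A} {f g : A → ℚ} →
           All (λ y → f y < g y) (x ∷ xs) → ∑ (x ∷ xs) f < ∑ (x ∷ xs) g
∑-mono-< (fx<gx ∷ [])          = ℚ.+-monoˡ-< 0ℚ fx<gx
∑-mono-< (fx<gx ∷ f<g@(_ ∷ _)) = ℚ.+-mono-< fx<gx (∑-mono-< f<g)

∑-vecs-suc : (xs : List A) (n : ℕ) (f : Vec A (suc n) → ℚ) →
             ∑ (vecs xs (suc n)) f ≡ ∑[ x ∈ xs ] ∑[ v ∈ vecs xs n ] f (x ∷ v)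
∑-vecs-suc xs n f = trans (∑-concatMap _ xs f) (∑-cong xs (λ x → ∑-map (x ∷_) (vecs xs n) f))

∑-vecs²-suc : (as : List A) (bs : List B) (n : ℕ) (f : Vec A (suc n) → Vec B (suc n) → ℚ) →
              ∑[ u ∈ vecs as (suc n) ] ∑[ v ∈ vecs bs (suc n) ] f u v
                ≡ ∑[ a ∈ as ] ∑[ b ∈ bs ] ∑[ u ∈ vecs as n ] ∑[ v ∈ vecs bs n ] f (a ∷ u) (b ∷ v)
∑-vecs²-suc as bs n f = begin
  ∑[ u ∈ vecs as (suc n) ] ∑[ v ∈ vecs bs (suc n) ] f u v
    ≡⟨ ∑-vecs-suc as n _ ⟩
  ∑[ a ∈ as ] ∑[ u ∈ vecs as n ] ∑[ v ∈ vecs bs (suc n) ] f (a ∷ u) v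
    ≡⟨ ∑-cong as (λ a → ∑-cong (vecs as n) (λ u → ∑-vecs-suc bs n (f (a ∷ u)))) ⟩
  ∑[ a ∈ as ] ∑[ u ∈ vecs as n ] ∑[ b ∈ bs ] ∑[ v ∈ vecs bs n ] f (a ∷ u) (b ∷ v)
    ≡⟨ ∑-cong as (λ a → ∑-comm (vecs as n) bs _) ⟩
  ∑[ a ∈ as ] ∑[ b ∈ bs ] ∑[ u ∈ vecs as n ] ∑[ v ∈ vecs bs n ] f (a ∷ u) (b ∷ v) ∎
  where open ≡-Reasoning

sumFin≡sum : ∀ n (f : Fin n → ℚ) → sumFin n f ≡ sum f
sumFin≡sum zero    f = refl
sumFin≡sum (suc n) f = cong (f zero +_) (begin
  sumℚ (map f (tabulate suc))   ≡⟨ cong sumℚ (List.map-tabulate suc f) ⟩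
  sumℚ (tabulate (f ∘ suc))     ≡⟨ cong sumℚ (List.map-tabulate (λ i → i) (f ∘ suc)) ⟨
  sumFin n (f ∘ suc)            ≡⟨ sumFin≡sum n (f ∘ suc) ⟩
  sum (f ∘ suc)                 ∎)
  where open ≡-Reasoning

sumFin-punchIn : ∀ {n} (i : Fin (suc n)) (f : Fin (suc n) → ℚ) →
                 sumFin (suc n) f ≡ f i + sumFin n (f ∘ punchIn i)
sumFin-punchIn {n} i f = begin
  sumFin (suc n) f               ≡⟨ sumFin≡sum (suc n) f ⟩
  sum f                          ≡⟨ sum-remove f ⟩
  f i + sum (f ∘ punchIn i)      ≡⟨ cong (f i +_) (sumFin≡sum n (f ∘ punchIn i)) ⟨
  f i + sumFin n (f ∘ punchIn i) ∎
  where open ≡-Reasoning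

sumFin-const : ∀ n (c : ℚ) → sumFin n (λ _ → c) ≡ n · c
sumFin-const n c = trans (sumFin≡sum n (λ _ → c)) (sum-replicate n)

∃-≤-of-sumFin-≤ : ∀ {n} (f g : Fin (suc n) → ℚ) →
                  sumFin (suc n) f ℚ.≤ sumFin (suc n) g → ∃ λ i → f i ℚ.≤ g i
∃-≤-of-sumFin-≤ {n} f g ∑f≤∑g with any? (λ i → f i ℚ.≤? g i) (allFin (suc n))
... | yes some = satisfied some
... | no none  = contradiction (ℚ.<-≤-trans ∑g<∑f ∑f≤∑g) (ℚ.<-irrefl refl)
  where
  ∑g<∑f : sumFin (suc n) g < sumFin (suc n) f
  ∑g<∑f = ∑-mono-< (All.map ℚ.≰⇒> (¬Any⇒All¬ (allFin (suc n)) none))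

toℚᵘ-·-etaOf : ∀ j d → toℚᵘ (j · etaOf (suc d)) ℚᵘ.≃ mkℚᵘ (ℤ.+ j) d
toℚᵘ-·-etaOf zero    d = *≡* refl
toℚᵘ-·-etaOf (suc j) d = begin
  toℚᵘ (q + j · q)                     ≈⟨ ℚ.toℚᵘ-homo-+ q (j · q) ⟩
  toℚᵘ q ℚᵘ.+ toℚᵘ (j · q)             ≈⟨ ℚᵘ.+-cong (ℚ.toℚᵘ-fromℚᵘ (mkℚᵘ (ℤ.+ 1) d))
                                                       (toℚᵘ-·-etaOf j d) ⟩
  mkℚᵘ (ℤ.+ 1) d ℚᵘ.+ mkℚᵘ (ℤ.+ j) d   ≈⟨ *≡* same-denominator ⟩
  mkℚᵘ (ℤ.+ suc j) d                   ∎
  where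
  open ℚᵘ.≃-Reasoning
  q : ℚ
  q = etaOf (suc d)
  numerators : ∀ (D J : ℤ) → (ℤ.1ℤ ℤ.* D ℤ.+ J ℤ.* D) ℤ.* D ≡ (ℤ.1ℤ ℤ.+ J) ℤ.* (D ℤ.* D)
  numerators = solve-∀
  same-denominator : (ℤ.1ℤ ℤ.* ℤ.+ suc d ℤ.+ ℤ.+ j ℤ.* ℤ.+ suc d) ℤ.* ℤ.+ suc d
                       ≡ ℤ.+ suc j ℤ.* ℤ.+ (suc d ℕ.* suc d)
  same-denominator = trans (numerators (ℤ.+ suc d) (ℤ.+ j))
                           (cong (ℤ.+ suc j ℤ.*_) (ℤ.pos-* (suc d) (suc d)))

uniform-mass : ∀ n .{{_ : NonZero n}} → sumFin n (λ _ → etaOf n) ≡ 1ℚ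
uniform-mass (suc d) = trans (sumFin-const (suc d) (etaOf (suc d)))
  (ℚ.toℚᵘ-injective (ℚᵘ.≃-trans (toℚᵘ-·-etaOf (suc d) d) (*≡* (ℤ.*-comm (ℤ.+ suc d) (ℤ.+ 1)))))

Law : Set → Set
Law Y = List (ℚ × Y)

mass : Law Y → ℚ
mass π = ∑ π proj₁

-- A Mixture k is a Law on concepts, and errMixture k D h c⋆ is 𝔼 h (λ c → errConcept k D c c⋆).
𝔼 : Law Y → (Y → ℚ) → ℚ
𝔼 π H = ∑[ wy ∈ π ] (proj₁ wy * H (proj₂ wy))

𝔼-cong : (π : Law Y) {H H′ : Y → ℚ} → (∀ y → H y ≡ H′ y) → 𝔼 π H ≡ 𝔼 π H′
𝔼-cong π H≗H′ = ∑-cong π (λ wy → cong (proj₁ wy *_) (H≗H′ (proj₂ wy)))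

𝔼-∑ : (π : Law Y) (is : List I) (F : I → Y → ℚ) →
      𝔼 π (λ y → ∑[ i ∈ is ] F i y) ≡ ∑[ i ∈ is ] 𝔼 π (F i)
𝔼-∑ π is F = trans (∑-cong π (λ wy → sym (∑-*ˡ is (proj₁ wy) (λ i → F i (proj₂ wy)))))
                   (∑-comm π is (λ wy i → proj₁ wy * F i (proj₂ wy)))

𝔼-const-on : {π : Law Y} {H : Y → ℚ} {c : ℚ} →
             All (λ wy → H (proj₂ wy) ≡ c) π → 𝔼 π H ≡ mass π * c
𝔼-const-on {π = π} {c = c} H≡c =
  trans (∑-cong-on (All.map (λ {wy} → cong (proj₁ wy *_)) H≡c)) (∑-*ʳ π c proj₁)

𝔼ⁿ : Law Y → (n : ℕ) → (Vec Y n → ℚ) → ℚ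
𝔼ⁿ π zero    G = G []
𝔼ⁿ π (suc n) G = 𝔼 π (λ y → 𝔼ⁿ π n (λ ys → G (y ∷ ys)))

𝔼ⁿ-cong : (π : Law Y) (n : ℕ) {G G′ : Vec Y n → ℚ} →
          (∀ ys → G ys ≡ G′ ys) → 𝔼ⁿ π n G ≡ 𝔼ⁿ π n G′
𝔼ⁿ-cong π zero    G≗G′ = G≗G′ []
𝔼ⁿ-cong π (suc n) G≗G′ = 𝔼-cong π (λ y → 𝔼ⁿ-cong π n (λ ys → G≗G′ (y ∷ ys)))

𝔼ⁿ-cong-law : {π ρ : Law Y} → (∀ H → 𝔼 π H ≡ 𝔼 ρ H) →
              ∀ n (G : Vec Y n → ℚ) → 𝔼ⁿ π n G ≡ 𝔼ⁿ ρ n G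
𝔼ⁿ-cong-law π≈ρ zero    G = refl
𝔼ⁿ-cong-law {π = π} π≈ρ (suc n) G =
  trans (𝔼-cong π (λ y → 𝔼ⁿ-cong-law π≈ρ n (λ ys → G (y ∷ ys)))) (π≈ρ _)

𝔼ⁿ-∑ : (π : Law Y) (n : ℕ) (is : List I) (F : I → Vec Y n → ℚ) →
       𝔼ⁿ π n (λ ys → ∑[ i ∈ is ] F i ys) ≡ ∑[ i ∈ is ] 𝔼ⁿ π n (F i)
𝔼ⁿ-∑ π zero    is F = refl
𝔼ⁿ-∑ π (suc n) is F =
  trans (𝔼-cong π (λ y → 𝔼ⁿ-∑ π n is (λ i ys → F i (y ∷ ys))))
        (𝔼-∑ π is (λ i y → 𝔼ⁿ π n (λ ys → F i (y ∷ ys))))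

𝔼ⁿ-1 : {π : Law Y} → mass π ≡ 1ℚ → ∀ n → 𝔼ⁿ π n (λ _ → 1ℚ) ≡ 1ℚ
𝔼ⁿ-1 mass≡1 zero    = refl
𝔼ⁿ-1 {π = π} mass≡1 (suc n) =
  trans (𝔼-const-on (All.universal (λ _ → 𝔼ⁿ-1 mass≡1 n) π))
        (trans (cong (_* 1ℚ) mass≡1) (ℚ.*-identityʳ 1ℚ))

uniformOn : (n : ℕ) .{{_ : NonZero n}} → (Fin n → Y) → Law Y
uniformOn n f = map (λ x → (etaOf n , f x)) (allFin n)

𝔼-uniformOn : (n : ℕ) .{{_ : NonZero n}} (f : Fin n → Y) (H : Y → ℚ) →
              𝔼 (uniformOn n f) H ≡ sumFin n (λ x → etaOf n * H (f x))
𝔼-uniformOn n f H = ∑-map _ (allFin n) _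

mass-uniformOn : (n : ℕ) .{{_ : NonZero n}} (f : Fin n → Y) → mass (uniformOn n f) ≡ 1ℚ
mass-uniformOn n f = trans (∑-map _ (allFin n) proj₁) (uniform-mass n)

planting : {k n : ℕ} → Point k → Adversary k n
planting {n = n} p _ _ = replicate n p

module _ {k : ℕ} (η : ℚ) (D : Fin k → ℚ) (c : Fin k → Bool) (p : Point k) where

  pointWeight : Bool → Fin k → ℚ
  pointWeight b x = (if b then η else 1ℚ - η) * D x

  observed : Bool → Fin k → Point k
  observed b x = if b then p else (x , c x)

  noisyPoint : Law (Point k)
  noisyPoint = concatMap (λ b → map (λ x → (pointWeight b x , observed b x)) (allFin k)) bools

  𝔼-noisyPoint : (H : Point k → ℚ) →
                 𝔼 noisyPoint H ≡ ∑[ b ∈ bools ] ∑[ x ∈ allFin k ] (pointWeight b x * H (observed b x))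
  𝔼-noisyPoint H =
    trans (∑-concatMap (λ b → map (point b) (allFin k)) bools (λ wy → proj₁ wy * H (proj₂ wy)))
          (∑-cong bools (λ b → ∑-map (point b) (allFin k) (λ wy → proj₁ wy * H (proj₂ wy))))
    where
    point : Bool → Fin k → ℚ × Point k
    point b x = (pointWeight b x , observed b x)

  ∑-noisySamples : ∀ n (G : Vec (Point k) n → ℚ) →
                   ∑[ ms ∈ vecs bools n ] ∑[ xs ∈ vecs (allFin k) n ]
                     (weight η D ms xs * G (mkSample c ms xs (replicate n p)))
                     ≡ 𝔼ⁿ noisyPoint n G
  ∑-noisySamples zero    G = trans (ℚ.+-identityʳ _) (trans (ℚ.+-identityʳ _) (ℚ.*-identityˡ (G [])))
  ∑-noisySamples (suc n) G = begin
    ∑[ ms ∈ vecs bools (suc n) ] ∑[ xs ∈ vecs (allFin k) (suc n) ] (weight η D ms xs * G (sample ms xs))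
      ≡⟨ ∑-vecs²-suc bools (allFin k) n _ ⟩
    ∑[ b ∈ bools ] ∑[ x ∈ allFin k ] ∑[ ms ∈ vecs bools n ] ∑[ xs ∈ vecs (allFin k) n ]
      (pointWeight b x * weight η D ms xs * G (observed b x ∷ sample ms xs))
      ≡⟨ ∑-cong bools (λ b → ∑-cong (allFin k) (pull-out b)) ⟩
    ∑[ b ∈ bools ] ∑[ x ∈ allFin k ] (pointWeight b x * 𝔼ⁿ noisyPoint n (λ ys → G (observed b x ∷ ys)))
      ≡⟨ 𝔼-noisyPoint _ ⟨
    𝔼ⁿ noisyPoint (suc n) G ∎
    where
    open ≡-Reasoning
    sample : ∀ {n} → Vec Bool n → Vec (Fin k) n → Vec (Point k) n
    sample {n} ms xs = mkSample c ms xs (replicate n p)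
    pull-out : ∀ b x →
      ∑[ ms ∈ vecs bools n ] ∑[ xs ∈ vecs (allFin k) n ]
        (pointWeight b x * weight η D ms xs * G (observed b x ∷ sample ms xs))
        ≡ pointWeight b x * 𝔼ⁿ noisyPoint n (λ ys → G (observed b x ∷ ys))
    pull-out b x = begin
      ∑[ ms ∈ Ms ] ∑[ xs ∈ Xs ] (w * weight η D ms xs * G′ (sample ms xs))
        ≡⟨ ∑-cong Ms (λ ms → trans (∑-cong Xs (λ xs → ℚ.*-assoc w _ _)) (∑-*ˡ Xs w _)) ⟩
      ∑[ ms ∈ Ms ] (w * ∑[ xs ∈ Xs ] (weight η D ms xs * G′ (sample ms xs)))
        ≡⟨ ∑-*ˡ Ms w _ ⟩
      w * ∑[ ms ∈ Ms ] ∑[ xs ∈ Xs ] (weight η D ms xs * G′ (sample ms xs))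
        ≡⟨ cong (w *_) (∑-noisySamples n G′) ⟩
      w * 𝔼ⁿ noisyPoint n G′ ∎
      where
      Ms : List (Vec Bool n)
      Ms = vecs bools n
      Xs : List (Vec (Fin k) n)
      Xs = vecs (allFin k) n
      w : ℚ
      w = pointWeight b x
      G′ : Vec (Point k) n → ℚ
      G′ ys = G (observed b x ∷ ys)

expectedError-planting : (k n : ℕ) (η : ℚ) (D : Fin k → ℚ) (c : Fin k → Bool)
                         (A : Algorithm k n) (p : Point k) →
                         expectedError k n η D c A (planting p)
                           ≡ 𝔼ⁿ (noisyPoint η D c p) n (λ S → errMixture k D (A S) c)
expectedError-planting k n η D c A p =
  trans (sum-concatMap _ (vecs bools n)) (∑-noisySamples η D c p n (λ S → errMixture k D (A S) c))

InSk⇒∑-positive≡1 : ∀ {n} {c : Fin n → Bool} → InSk c → sumFin n (λ x → disagree (c x) false) ≡ 1ℚ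
InSk⇒∑-positive≡1 {suc n} {c} (j , cj≡true , unique) = begin
  sumFin (suc n) positive                   ≡⟨ sumFin-punchIn j positive ⟩
  positive j + sumFin n (positive ∘ punchIn j)
    ≡⟨ cong₂ _+_ (cong (λ b → disagree b false) cj≡true)
                 (∑-cong (allFin n) (λ y → cong (λ b → disagree b false) (c-punchIn y))) ⟩
  1ℚ + ∑[ _ ∈ allFin n ] 0ℚ                 ≡⟨ cong (1ℚ +_) (∑-0 (allFin n)) ⟩
  1ℚ + 0ℚ                                   ≡⟨ ℚ.+-identityʳ 1ℚ ⟩
  1ℚ                                        ∎
  where
  open ≡-Reasoning
  positive : Fin (suc n) → ℚ
  positive x = disagree (c x) false
  c-punchIn : ∀ y → c (punchIn j y) ≡ false
  c-punchIn y with c (punchIn j y) in cy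
  ... | true  = contradiction (unique _ cy) (punchInᵢ≢i j y)
  ... | false = refl

-- The domain here is [k + 1] = Fin (suc k), so the k of the statement is suc k.
module HardInstance (k : ℕ) .{{_ : NonZero k}} where

  η v : ℚ
  η = etaOf (suc k)
  v = etaOf k

  target : Fin (suc k) → Fin (suc k) → Bool
  target i x = does (x ≟ i)

  avoiding : Fin (suc k) → Fin (suc k) → ℚ
  avoiding i x = if target i x then 0ℚ else v

  instanceError : (n : ℕ) → Algorithm (suc k) n → Fin (suc k) → ℚ
  instanceError n A i = expectedError (suc k) n η (avoiding i) (target i) A (planting (i , false))

  uniformNegative : Law (Point (suc k))
  uniformNegative = uniformOn (suc k) (λ y → (y , false))

  target-self : ∀ i → target i i ≡ true
  target-self i = dec-true (i ≟ i) refl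

  target-punchIn : ∀ i y → target i (punchIn i y) ≡ false
  target-punchIn i y = dec-false (punchIn i y ≟ i) (punchInᵢ≢i i y)

  target-sym : ∀ i x → target i x ≡ target x i
  target-sym i x = does-⇔ (mk⇔ sym sym) (x ≟ i) (i ≟ x)

  target-InSk : ∀ i → InSk (target i)
  target-InSk i = i , target-self i , positive
    where
    positive : ∀ x → target i x ≡ true → x ≡ i
    positive x _  with x ≟ i
    positive x _  | yes x≡i = x≡i
    positive x () | no _

  avoiding-self : ∀ i → avoiding i i ≡ 0ℚ
  avoiding-self i = cong (λ b → if b then 0ℚ else v) (target-self i)

  avoiding-punchIn : ∀ i y → avoiding i (punchIn i y) ≡ v
  avoiding-punchIn i y = cong (λ b → if b then 0ℚ else v) (target-punchIn i y)

  avoiding-sym : ∀ i x → avoiding i x ≡ avoiding x i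
  avoiding-sym i x = cong (λ b → if b then 0ℚ else v) (target-sym i x)

  avoiding-mass : ∀ i → sumFin (suc k) (avoiding i) ≡ 1ℚ
  avoiding-mass i = begin
    sumFin (suc k) (avoiding i)                        ≡⟨ sumFin-punchIn i (avoiding i) ⟩
    avoiding i i + sumFin k (avoiding i ∘ punchIn i)
      ≡⟨ cong₂ _+_ (avoiding-self i) (∑-cong (allFin k) (avoiding-punchIn i)) ⟩
    0ℚ + sumFin k (λ _ → v)                            ≡⟨ ℚ.+-identityˡ _ ⟩
    sumFin k (λ _ → v)                                 ≡⟨ uniform-mass k ⟩
    1ℚ                                                 ∎
    where open ≡-Reasoning

  avoiding-IsDist : ∀ i → IsDist (suc k) (avoiding i)
  avoiding-IsDist i = nonNegative , avoiding-mass i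
    where
    nonNegative : ∀ x → 0ℚ ℚ.≤ avoiding i x
    nonNegative x with target i x
    ... | true  = ℚ.≤-refl
    ... | false = ℚ.nonNegative⁻¹ v {{ℚ.normalize-nonNeg 1 k}}

  [1-η]*v≡η : (1ℚ - η) * v ≡ η
  [1-η]*v≡η = begin
    (1ℚ - η) * v                         ≡⟨ cong (λ t → (t - η) * v) 1≡η+rest ⟩
    ((η + rest) - η) * v                 ≡⟨ solve 3 (λ a s w → ((a :+ s) :- a) :* w := s :* w) refl η rest v ⟩
    rest * v                             ≡⟨ ∑-*ʳ (allFin k) v (λ _ → η) ⟨
    sumFin k (λ _ → η * v)               ≡⟨ ∑-*ˡ (allFin k) η (λ _ → v) ⟩
    η * sumFin k (λ _ → v)               ≡⟨ cong (η *_) (uniform-mass k) ⟩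
    η * 1ℚ                               ≡⟨ ℚ.*-identityʳ η ⟩
    η                                    ∎
    where
    open ≡-Reasoning
    rest : ℚ
    rest = sumFin k (λ _ → η)
    1≡η+rest : 1ℚ ≡ η + rest
    1≡η+rest = trans (sym (uniform-mass (suc k))) (sumFin-punchIn {k} zero (λ _ → η))

  noisyPoint≈uniformNegative : ∀ i (H : Point (suc k) → ℚ) →
                               𝔼 (noisyPoint η (avoiding i) (target i) (i , false)) H ≡ 𝔼 uniformNegative H
  noisyPoint≈uniformNegative i H = begin
    𝔼 (noisyPoint η (avoiding i) (target i) (i , false)) H
      ≡⟨ 𝔼-noisyPoint η (avoiding i) (target i) (i , false) H ⟩
    sumFin (suc k) clean + (sumFin (suc k) (λ x → η * avoiding i x * H (i , false)) + 0ℚ)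
      ≡⟨ cong₂ (λ s t → s + (t + 0ℚ)) clean-sum planted-sum ⟩
    others + (η * H (i , false) + 0ℚ)
      ≡⟨ solve 2 (λ s a → s :+ (a :+ con 0ℚ) := a :+ s) refl others (η * H (i , false)) ⟩
    η * H (i , false) + others
      ≡⟨ sumFin-punchIn i (λ x → η * H (x , false)) ⟨
    sumFin (suc k) (λ x → η * H (x , false))
      ≡⟨ 𝔼-uniformOn (suc k) (λ y → (y , false)) H ⟨
    𝔼 uniformNegative H ∎
    where
    open ≡-Reasoning
    others : ℚ
    others = sumFin k (λ y → η * H (punchIn i y , false))
    clean : Fin (suc k) → ℚ
    clean x = (1ℚ - η) * avoiding i x * H (x , target i x)
    clean-at-i : clean i ≡ 0ℚ
    clean-at-i rewrite avoiding-self i =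
      trans (cong (_* H (i , target i i)) (ℚ.*-zeroʳ (1ℚ - η))) (ℚ.*-zeroˡ (H (i , target i i)))
    clean-at-punchIn : ∀ y → clean (punchIn i y) ≡ η * H (punchIn i y , false)
    clean-at-punchIn y rewrite avoiding-punchIn i y | target-punchIn i y =
      cong (_* H (punchIn i y , false)) [1-η]*v≡η
    clean-sum : sumFin (suc k) clean ≡ others
    clean-sum = begin
      sumFin (suc k) clean                     ≡⟨ sumFin-punchIn i clean ⟩
      clean i + sumFin k (clean ∘ punchIn i)   ≡⟨ cong₂ _+_ clean-at-i (∑-cong (allFin k) clean-at-punchIn) ⟩
      0ℚ + others                              ≡⟨ ℚ.+-identityˡ others ⟩
      others                                   ∎
    planted-sum : sumFin (suc k) (λ x → η * avoiding i x * H (i , false)) ≡ η * H (i , false)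
    planted-sum = begin
      sumFin (suc k) (λ x → η * avoiding i x * H (i , false))
        ≡⟨ ∑-*ʳ (allFin (suc k)) (H (i , false)) (λ x → η * avoiding i x) ⟩
      sumFin (suc k) (λ x → η * avoiding i x) * H (i , false)
        ≡⟨ cong (_* H (i , false)) (∑-*ˡ (allFin (suc k)) η (avoiding i)) ⟩
      η * sumFin (suc k) (avoiding i) * H (i , false)
        ≡⟨ cong (λ t → η * t * H (i , false)) (avoiding-mass i) ⟩
      η * 1ℚ * H (i , false)
        ≡⟨ cong (_* H (i , false)) (ℚ.*-identityʳ η) ⟩
      η * H (i , false) ∎

  avoiding-disagree : ∀ i x b → avoiding i x * disagree b (target i x) ≡ avoiding i x * disagree b false
  avoiding-disagree i x b with target i x
  ... | true  = trans (ℚ.*-zeroˡ (disagree b true)) (sym (ℚ.*-zeroˡ (disagree b false)))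
  ... | false = refl

  errConcept-∑ : ∀ {c} → InSk c →
                 ∑[ i ∈ allFin (suc k) ] errConcept (suc k) (avoiding i) c (target i) ≡ 1ℚ
  errConcept-∑ {c} c∈S = begin
    ∑[ i ∈ X ] ∑[ x ∈ X ] (avoiding i x * disagree (c x) (target i x))
      ≡⟨ ∑-cong X (λ i → ∑-cong X (λ x → avoiding-disagree i x (c x))) ⟩
    ∑[ i ∈ X ] ∑[ x ∈ X ] (avoiding i x * positive x)
      ≡⟨ ∑-comm X X (λ i x → avoiding i x * positive x) ⟩
    ∑[ x ∈ X ] ∑[ i ∈ X ] (avoiding i x * positive x)
      ≡⟨ ∑-cong X (λ x → ∑-*ʳ X (positive x) (λ i → avoiding i x)) ⟩
    ∑[ x ∈ X ] (∑[ i ∈ X ] avoiding i x * positive x)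
      ≡⟨ ∑-cong X (λ x → cong (_* positive x) (trans (∑-cong X (λ i → avoiding-sym i x))
                                                        (avoiding-mass x))) ⟩
    ∑[ x ∈ X ] (1ℚ * positive x)
      ≡⟨ ∑-cong X (λ x → ℚ.*-identityˡ (positive x)) ⟩
    sumFin (suc k) positive
      ≡⟨ InSk⇒∑-positive≡1 c∈S ⟩
    1ℚ ∎
    where
    open ≡-Reasoning
    X : List (Fin (suc k))
    X = allFin (suc k)
    positive : Fin (suc k) → ℚ
    positive x = disagree (c x) false

  errMixture-∑ : ∀ {h} → ValidMixture h →
                 ∑[ i ∈ allFin (suc k) ] errMixture (suc k) (avoiding i) h (target i) ≡ 1ℚ
  errMixture-∑ {h} (valid , mass≡1) = begin
    ∑[ i ∈ allFin (suc k) ] 𝔼 h (λ c → errConcept (suc k) (avoiding i) c (target i))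
      ≡⟨ 𝔼-∑ h (allFin (suc k)) _ ⟨
    𝔼 h (λ c → ∑[ i ∈ allFin (suc k) ] errConcept (suc k) (avoiding i) c (target i))
      ≡⟨ 𝔼-const-on (All.map (errConcept-∑ ∘ proj₂) valid) ⟩
    mass h * 1ℚ
      ≡⟨ cong (_* 1ℚ) mass≡1 ⟩
    1ℚ * 1ℚ
      ≡⟨ ℚ.*-identityʳ 1ℚ ⟩
    1ℚ ∎
    where open ≡-Reasoning

  instanceError-∑ : ∀ n (A : Algorithm (suc k) n) → (∀ S → ValidMixture (A S)) →
                    ∑[ i ∈ allFin (suc k) ] instanceError n A i ≡ 1ℚ
  instanceError-∑ n A valid = begin
    ∑[ i ∈ X ] instanceError n A i
      ≡⟨ ∑-cong X (λ i → trans (expectedError-planting (suc k) n η (avoiding i) (target i) A (i , false))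
                               (𝔼ⁿ-cong-law (noisyPoint≈uniformNegative i) n (F i))) ⟩
    ∑[ i ∈ X ] 𝔼ⁿ uniformNegative n (F i)
      ≡⟨ 𝔼ⁿ-∑ uniformNegative n X F ⟨
    𝔼ⁿ uniformNegative n (λ S → ∑[ i ∈ X ] F i S)
      ≡⟨ 𝔼ⁿ-cong uniformNegative n (λ S → errMixture-∑ (valid S)) ⟩
    𝔼ⁿ uniformNegative n (λ _ → 1ℚ)
      ≡⟨ 𝔼ⁿ-1 (mass-uniformOn (suc k) (λ y → (y , false))) n ⟩
    1ℚ ∎
    where
    open ≡-Reasoning
    X : List (Fin (suc k))
    X = allFin (suc k)
    F : Fin (suc k) → Vec (Point (suc k)) n → ℚ
    F i S = errMixture (suc k) (avoiding i) (A S) (target i)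

  some-instanceError-≥η : ∀ n (A : Algorithm (suc k) n) → (∀ S → ValidMixture (A S)) →
                          ∃ λ i → η ℚ.≤ instanceError n A i
  some-instanceError-≥η n A valid = ∃-≤-of-sumFin-≤ (λ _ → η) (instanceError n A)
    (ℚ.≤-reflexive (trans (uniform-mass (suc k)) (sym (instanceError-∑ n A valid))))

claim11p1 : (k : ℕ) → .{{_ : NonZero k}} → 2 ≤ k → (n : ℕ) → (A : Algorithm k n)
    → (∀ S → ValidMixture (A S))
    → Σ (Fin k → Bool) λ c⋆ → InSk c⋆
      × Σ (Fin k → ℚ) λ D → IsDist k D
      × Σ (Adversary k n) λ adv → etaOf k Data.Rational.≤ expectedError k n (etaOf k) D c⋆ A adv
claim11p1 (suc (suc m)) (s≤s (s≤s _)) n A valid =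
  let i , η≤Eᵢ = some-instanceError-≥η n A valid
  in  target i , target-InSk i , avoiding i , avoiding-IsDist i , planting (i , false) , η≤Eᵢ
  where open HardInstance (suc m)
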